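{- Let $b,h\in\omega^\omega$. Then there exists $b^+\in\omega^\omega$ such that $\mathbf{R}_b\preceq_T\mathbf{LLc}(b^+,h)$.
   Context: $\mathbf{R}\preceq_T\mathbf{R}'$ for relational systems $\mathbf{R}=\langle X,Y,\sqsubset\rangle$, $\mathbf{R}'=\langle X',Y',\sqsubset'\rangle$ means there are $\Phi_-:X\to X'$, $\Phi_+:Y'\to Y$ with $\Phi_-(x)\sqsubset'y'\Rightarrow x\sqsubset\Phi_+(y')$. $\mathbb{IP}$ is the set of interval partitions of $\omega$. For $f,g\in\omega^\omega$ and $I=\langle I_k:k<\omega\rangle\in\mathbb{IP}$, $f\sqsubset^\bullet(I,g)$ iff for all but finitely many $k<\omega$ there is $i\in I_k$ with $f(i)=g(i)$. $\mathbf{R}_b=\langle\prod b,\mathbb{IP}\times\prod b,\sqsubset^\bullet\rangle$, where $\prod b=\prod_nb(n)$. For $b,h\in\omega^\omega$, $\mathcal{S}(b,h)=\prod_n[b(n)]^{\leq h(n)}$ and $\mathbf{LLc}(b,h)=\langle\prod b,[\omega]^\omega\times\mathcal{S}(b,h),\sqsubset\rangle$ with $x\sqsubset(D,\varphi)$ iff $x(n)\in\varphi(n)$ for all but finitely many $n\in D$. -}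

module Defs where

open import Data.Nat using (ℕ; zero; suc; _≤_; _<_)
open import Data.Fin using (Fin)
open import Data.Fin.Subset using (Subset; ∣_∣; _∈_)
open import Data.Bool using (Bool; true)
open import Data.Product using (Σ; ∃; ∃-syntax; _×_)
open import Relation.Binary.PropositionalEquality using (_≡_)

record RelSys : Set₁ where
  field
    X   : Set
    Y   : Set
    rel : X → Y → Set
open RelSys public

infix 4 _≼T_
_≼T_ : RelSys → RelSys → Set
R ≼T R' = Σ (X R → X R') λ Φ₋ → Σ (Y R' → Y R) λ Φ₊ →
            ∀ (x : X R) (y' : Y R') → rel R' (Φ₋ x) y' → rel R x (Φ₊ y')

Prod : (ℕ → ℕ) → Set
Prod b = (n : ℕ) → Fin (b n)

-- Interval partitions of ω: I_k = [start k, start (k+1)), start 0 = 0, strictly increasing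
record IP : Set where
  field
    start  : ℕ → ℕ
    start0 : start 0 ≡ 0
    incr   : ∀ k → start k < start (suc k)
open IP public

_⊏•_ : {b : ℕ → ℕ} → Prod b → IP × Prod b → Set
_⊏•_ f (I Data.Product., g) =
  ∃[ K ] ∀ k → K ≤ k → ∃[ i ] (start I k ≤ i × i < start I (suc k) × f i ≡ g i)

Rb : (ℕ → ℕ) → RelSys
Rb b = record { X = Prod b ; Y = IP × Prod b ; rel = _⊏•_ {b} }

InfSubset : Set
InfSubset = Σ (ℕ → Bool) λ D → ∀ n → ∃[ m ] (n ≤ m × D m ≡ true)

S : (ℕ → ℕ) → (ℕ → ℕ) → Set
S b h = (n : ℕ) → Σ (Subset (b n)) λ s → ∣ s ∣ ≤ h n

_⊏LLc_ : {b h : ℕ → ℕ} → Prod b → InfSubset × S b h → Set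
_⊏LLc_ x ((D Data.Product., _) Data.Product., φ) =
  ∃[ N ] ∀ n → N ≤ n → D n ≡ true → x n ∈ Data.Product.proj₁ (φ n)

LLc : (ℕ → ℕ) → (ℕ → ℕ) → RelSys
LLc b h = record { X = Prod b ; Y = InfSubset × S b h ; rel = _⊏LLc_ {b} {h} }

{-# OPTIONS --safe #-}
-- Cut ω into consecutive blocks J n of length h n + 1 and let b⁺ n be the number of
-- restrictions to J n of points of ∏ b, so that Φ₋ x n codes x ↾ J n. A slalom value φ n
-- holds at most h n codes; on the j-th point of J n guess according to the j-th of them.
-- If Φ₋ x n ∈ φ n for almost all n in an infinite D, then x meets the guess inside J n
-- for these n; so x ⊏• the guess with respect to the interval partition whose k-th
-- interval ends with the block J n of the k-th element n of D.
module Submission where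

open import Defs
open import Data.Bool using (Bool; true; false)
open import Data.Empty using (⊥-elim)
open import Data.Fin using (Fin; combine; remQuot; fromℕ<)
import Data.Fin as Fin
open import Data.Fin.Properties using (remQuot-combine)
open import Data.Fin.Subset using (Subset; ∣_∣; _∈_)
open import Data.Maybe using (Maybe; just; nothing; maybe′)
import Data.Maybe as Maybe
open import Data.Nat using (ℕ; zero; suc; _+_; _*_; _≤_; _<_; z≤n; s≤s; _≟_; _<?_)
open import Data.Nat.Properties
open import Data.Product using (Σ; _×_; _,_; proj₁; proj₂; ∃-syntax)
open import Data.Sum using (inj₁; inj₂)
open import Data.Vec using ([]; _∷_; here; there)
open import Function using (_∘_)
open import Relation.Nullary using (yes; no)
open import Relation.Binary.PropositionalEquality

nth : ∀ {m} → Subset m → ℕ → Maybe (Fin m)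
nth []          _       = nothing
nth (true ∷ p)  zero    = just Fin.zero
nth (true ∷ p)  (suc j) = Maybe.map Fin.suc (nth p j)
nth (false ∷ p) j       = Maybe.map Fin.suc (nth p j)

∈⇒nth : ∀ {m} {x : Fin m} {p : Subset m} → x ∈ p → ∃[ j ] (j < ∣ p ∣ × nth p j ≡ just x)
∈⇒nth here = zero , s≤s z≤n , refl
∈⇒nth {p = true ∷ p} (there x∈p) with j , j<∣p∣ , eq ← ∈⇒nth x∈p =
  suc j , s≤s j<∣p∣ , cong (Maybe.map Fin.suc) eq
∈⇒nth {p = false ∷ p} (there x∈p) with j , j<∣p∣ , eq ← ∈⇒nth x∈p =
  j , j<∣p∣ , cong (Maybe.map Fin.suc) eq

module Blocks (ℓ : ℕ → ℕ) where

  offset : ℕ → ℕ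
  offset zero    = zero
  offset (suc n) = offset n + suc (ℓ n)

  offset-mono-≤ : ∀ {m n} → m ≤ n → offset m ≤ offset n
  offset-mono-≤ {n = zero} z≤n = ≤-refl
  offset-mono-≤ {m} {suc n} m≤1+n with m≤n⇒m<n∨m≡n m≤1+n
  ... | inj₂ refl      = ≤-refl
  ... | inj₁ (s≤s m≤n) = ≤-trans (offset-mono-≤ m≤n) (m≤m+n (offset n) (suc (ℓ n)))

  offset-mono-< : ∀ {m n} → m < n → offset m < offset n
  offset-mono-< {n = suc n} (s≤s m≤n) = ≤-<-trans (offset-mono-≤ m≤n) (m<m+n (offset n) (s≤s z≤n))

  next : ℕ × ℕ → ℕ × ℕ
  next (n , j) with j <? ℓ n
  ... | yes _ = n , suc j
  ... | no  _ = suc n , zero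

  next-inside : ∀ n j → j < ℓ n → next (n , j) ≡ (n , suc j)
  next-inside n j j<ℓn with j <? ℓ n
  ... | yes _    = refl
  ... | no  j≮ℓn = ⊥-elim (j≮ℓn j<ℓn)

  next-last : ∀ n → next (n , ℓ n) ≡ (suc n , zero)
  next-last n with ℓ n <? ℓ n
  ... | yes ℓn<ℓn = ⊥-elim (<-irrefl refl ℓn<ℓn)
  ... | no  _     = refl

  position : ℕ → ℕ × ℕ
  position zero    = zero , zero
  position (suc i) = next (position i)

  mutual
    position-offset : ∀ n → position (offset n) ≡ (n , zero)
    position-offset zero    = refl
    position-offset (suc n) = begin
      position (offset n + suc (ℓ n)) ≡⟨ cong position (+-suc (offset n) (ℓ n)) ⟩
      next (position (offset n + ℓ n)) ≡⟨ cong next (position-offset+ n (ℓ n) ≤-refl) ⟩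
      next (n , ℓ n)                   ≡⟨ next-last n ⟩
      (suc n , zero)                   ∎
      where open ≡-Reasoning

    position-offset+ : ∀ n j → j ≤ ℓ n → position (offset n + j) ≡ (n , j)
    position-offset+ n zero    _    = trans (cong position (+-identityʳ (offset n))) (position-offset n)
    position-offset+ n (suc j) j<ℓn = begin
      position (offset n + suc j) ≡⟨ cong position (+-suc (offset n) j) ⟩
      next (position (offset n + j)) ≡⟨ cong next (position-offset+ n j (<⇒≤ j<ℓn)) ⟩
      next (n , j)                   ≡⟨ next-inside n j j<ℓn ⟩
      (n , suc j)                    ∎
      where open ≡-Reasoning

  coarsen : (d : ℕ → ℕ) → (∀ k → d k < d (suc k)) → IP
  coarsen d d-< = record
    { start  = cut
    ; start0 = refl
    ; incr   = cut-<
    }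
    where
    cut : ℕ → ℕ
    cut zero    = zero
    cut (suc k) = offset (suc (d k))

    cut-< : ∀ k → cut k < cut (suc k)
    cut-< zero    = offset-mono-< (s≤s z≤n)
    cut-< (suc k) = offset-mono-< (s≤s (d-< k))

  block-⊆-coarsen : ∀ d d-< k j → j ≤ ℓ (d k) →
                    start (coarsen d d-<) k ≤ offset (d k) + j ×
                    offset (d k) + j < start (coarsen d d-<) (suc k)
  block-⊆-coarsen d d-< k j j≤ℓ =
    ≤-trans (start≤offset k) (m≤m+n (offset (d k)) j) , +-monoʳ-< (offset (d k)) (s≤s j≤ℓ)
    where
    start≤offset : ∀ k → start (coarsen d d-<) k ≤ offset (d k)
    start≤offset zero    = z≤n
    start≤offset (suc k) = offset-mono-≤ (d-< k)

module Window (b : ℕ → ℕ) where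

  size : ℕ → ℕ → ℕ
  size a zero    = 1
  size a (suc k) = b a * size (suc a) k

  encode : ∀ a k → Prod b → Fin (size a k)
  encode a zero    x = Fin.zero
  encode a (suc k) x = combine (x a) (encode (suc a) k x)

  -- Outside [a, a + k) the decoded point is y.
  decode : Prod b → ∀ a k → Fin (size a k) → Prod b
  decode y a zero    v i = y i
  decode y a (suc k) v i with i ≟ a
  ... | yes refl = proj₁ (remQuot {b a} (size (suc a) k) v)
  ... | no  _    = decode y (suc a) k (proj₂ (remQuot {b a} (size (suc a) k) v)) i

  decode-encode : ∀ y a k x i → a ≤ i → i < a + k → decode y a k (encode a k x) i ≡ x i
  decode-encode y a zero    x i a≤i i<a+0 = ⊥-elim (≤⇒≯ a≤i (subst (i <_) (+-identityʳ a) i<a+0))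
  decode-encode y a (suc k) x i a≤i i<a+1+k
    with i ≟ a | remQuot-combine {b a} {size (suc a) k} (x a) (encode (suc a) k x)
  ... | yes refl | split = cong proj₁ split
  ... | no  i≢a  | split = begin
    decode y (suc a) k (proj₂ (remQuot {b a} (size (suc a) k) (encode a (suc k) x))) i
      ≡⟨ cong (λ v → decode y (suc a) k v i) (cong proj₂ split) ⟩
    decode y (suc a) k (encode (suc a) k x) i
      ≡⟨ decode-encode y (suc a) k x i (≤∧≢⇒< a≤i (i≢a ∘ sym))
                                       (subst (i <_) (+-suc a k) i<a+1+k) ⟩
    x i ∎
    where open ≡-Reasoning

module Enumerate (D : ℕ → Bool) (unbounded : ∀ n → ∃[ m ] (n ≤ m × D m ≡ true)) where

  enum : ℕ → ℕ
  enum zero    = proj₁ (unbounded zero)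
  enum (suc k) = proj₁ (unbounded (suc (enum k)))

  enum-∈ : ∀ k → D (enum k) ≡ true
  enum-∈ zero    = proj₂ (proj₂ (unbounded zero))
  enum-∈ (suc k) = proj₂ (proj₂ (unbounded (suc (enum k))))

  enum-< : ∀ k → enum k < enum (suc k)
  enum-< k = proj₁ (proj₂ (unbounded (suc (enum k))))

  ≤-enum : ∀ k → k ≤ enum k
  ≤-enum zero    = z≤n
  ≤-enum (suc k) = ≤-<-trans (≤-enum k) (enum-< k)

module TukeyConnection (b h : ℕ → ℕ) (b>0 : ∀ n → 0 < b n) where
  open Blocks h
  open Window b

  b⁺ : ℕ → ℕ
  b⁺ n = size (offset n) (suc (h n))

  default : Prod b
  default i = fromℕ< (b>0 i)

  Φ₋ : Prod b → Prod b⁺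
  Φ₋ x n = encode (offset n) (suc (h n)) x

  candidate : S b⁺ h → ℕ → ℕ → Prod b
  candidate φ n j = maybe′ (decode default (offset n) (suc (h n))) default (nth (proj₁ (φ n)) j)

  guess : S b⁺ h → Prod b
  guess φ i = candidate φ (proj₁ (position i)) (proj₂ (position i)) i

  guess-hits : ∀ φ x n → Φ₋ x n ∈ proj₁ (φ n) →
               ∃[ j ] (j ≤ h n × x (offset n + j) ≡ guess φ (offset n + j))
  guess-hits φ x n x∈φn with j , j<∣φn∣ , nth≡ ← ∈⇒nth x∈φn = j , j≤hn , sym (begin
    guess φ i
      ≡⟨ cong (λ (m , l) → candidate φ m l i) (position-offset+ n j j≤hn) ⟩
    candidate φ n j i
      ≡⟨ cong (λ v → maybe′ decodeBlock default v i) nth≡ ⟩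
    decodeBlock (Φ₋ x n) i
      ≡⟨ decode-encode default (offset n) (suc (h n)) x i
                       (m≤m+n (offset n) j) (+-monoʳ-< (offset n) (s≤s j≤hn)) ⟩
    x i ∎)
    where
    open ≡-Reasoning
    i : ℕ
    i = offset n + j
    j≤hn : j ≤ h n
    j≤hn = <⇒≤ (<-≤-trans j<∣φn∣ (proj₂ (φ n)))
    decodeBlock : Fin (b⁺ n) → Prod b
    decodeBlock = decode default (offset n) (suc (h n))

  Φ₊ : InfSubset × S b⁺ h → IP × Prod b
  Φ₊ ((D , unbounded) , φ) = coarsen enum enum-< , guess φ
    where open Enumerate D unbounded

  Φ₋-⊏LLc⇒Φ₊-⊏• : ∀ (x : Prod b) (y : InfSubset × S b⁺ h) → Φ₋ x ⊏LLc y → x ⊏• Φ₊ y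
  Φ₋-⊏LLc⇒Φ₊-⊏• x ((D , unbounded) , φ) (N , x∈φ) = N , λ k N≤k →
    let n = enum k
        j , j≤hn , hit = guess-hits φ x n (x∈φ n (≤-trans N≤k (≤-enum k)) (enum-∈ k))
        start≤i , i<start = block-⊆-coarsen enum enum-< k j j≤hn
    in offset n + j , start≤i , i<start , hit
    where open Enumerate D unbounded

lemma5p11 : (b h : ℕ → ℕ) → (∀ n → 0 < b n) →
    Σ (ℕ → ℕ) λ b⁺ → Rb b ≼T LLc b⁺ h
lemma5p11 b h b>0 = b⁺ , Φ₋ , Φ₊ , Φ₋-⊏LLc⇒Φ₊-⊏•
  where open TukeyConnection b h b>0
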